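{- For every positive integer $n$, the set $B_{n+1}(132,321)$ is in bijection with $S_n(132,321)$; in particular $|B_{n+1}(132,321)|=|S_n(132,321)|$.
   Context: A permutation $\sigma\in S_n$ is written as $\sigma(1)\cdots\sigma(n)$. An index $i\in[n-1]$ is an ascent if $\sigma(i)<\sigma(i+1)$ and a descent if $\sigma(i)>\sigma(i+1)$. A ballot permutation is a permutation such that every prefix $\sigma(1)\cdots\sigma(p)$ has at least as many ascents as descents. $\sigma$ contains a pattern $\pi\in S_k$ if some subsequence $\sigma(c_1)\cdots\sigma(c_k)$ with $c_1<\dots<c_k$ is order-isomorphic to $\pi$, and avoids $\pi$ otherwise. $S_n(\pi_1,\dots,\pi_m)$ denotes the set of permutations of $[n]$ avoiding all of $\pi_1,\dots,\pi_m$, and $B_n(\pi_1,\dots,\pi_m)$ the set of ballot permutations of length $n$ avoiding all of them. -}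

module Defs where

open import Data.Nat using (ℕ; zero; suc; _<ᵇ_; _≡ᵇ_; _+_)
open import Data.Bool using (Bool; true; false; _∧_; _∨_; not; if_then_else_; T)
open import Data.List using (List; []; _∷_; length; map; upTo)
open import Data.Bool.ListAction using (all; any)
open import Data.Product using (Σ; _×_; _,_)

-- A word is a list of naturals; σ ∈ S_n is the list σ(1)⋯σ(n) of values in 1..n.

-- every element of [1..n] occurs in the list (and the list has length n):
-- together this says the list is a permutation of [n]
_∈ᵇ_ : ℕ → List ℕ → Bool
x ∈ᵇ [] = false
x ∈ᵇ (y ∷ ys) = (x ≡ᵇ y) ∨ (x ∈ᵇ ys)

isPermᵇ : ℕ → List ℕ → Bool
isPermᵇ n w = (length w ≡ᵇ n) ∧ all (λ i → suc i ∈ᵇ w) (upTo n)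

S : ℕ → Set
S n = Σ (List ℕ) λ w → T (isPermᵇ n w)

subseqs : List ℕ → List (List ℕ)
subseqs [] = [] ∷ []
subseqs (x ∷ xs) = let r = subseqs xs in map (x ∷_) r Data.List.++ r

-- two words of equal length are order-isomorphic
-- (for all positions i, j: u_i < u_j iff v_i < v_j)
pairsOK : ℕ → ℕ → List ℕ → List ℕ → Bool
pairsOK a b [] [] = true
pairsOK a b (x ∷ xs) (y ∷ ys) = ((a <ᵇ x) ≡ᵇᵇ (b <ᵇ y)) ∧ ((x <ᵇ a) ≡ᵇᵇ (y <ᵇ b)) ∧ pairsOK a b xs ys
  where
  _≡ᵇᵇ_ : Bool → Bool → Bool
  true ≡ᵇᵇ c = c
  false ≡ᵇᵇ c = not c
pairsOK a b _ _ = false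

orderIsoᵇ : List ℕ → List ℕ → Bool
orderIsoᵇ [] [] = true
orderIsoᵇ (x ∷ xs) (y ∷ ys) = pairsOK x y xs ys ∧ orderIsoᵇ xs ys
orderIsoᵇ _ _ = false

containsᵇ : List ℕ → List ℕ → Bool
containsᵇ σ π = any (λ u → orderIsoᵇ u π) (subseqs σ)

avoids : List ℕ → List ℕ → Set
avoids σ π = T (not (containsᵇ σ π))

-- ascents and descents
-- ballot: every prefix σ(1)⋯σ(p) has #ascents ≥ #descents.
-- We track (ascents - descents) as a running balance; it must never go negative.
ballotFrom : ℕ → ℕ → List ℕ → Bool
ballotFrom prev bal [] = true
ballotFrom prev bal (x ∷ xs) with prev <ᵇ x
... | true  = ballotFrom x (suc bal) xs
... | false with bal
...   | zero    = false
...   | suc bal' = ballotFrom x bal' xs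

isBallotᵇ : List ℕ → Bool
isBallotᵇ [] = true
isBallotᵇ (x ∷ xs) = ballotFrom x 0 xs

isBallot : List ℕ → Set
isBallot σ = T (isBallotᵇ σ)

p132 p321 : List ℕ
p132 = 1 ∷ 3 ∷ 2 ∷ []
p321 = 3 ∷ 2 ∷ 1 ∷ []

S-132-321 : ℕ → Set
S-132-321 n = Σ (S n) λ { (σ , _) → avoids σ p132 × avoids σ p321 }

B-132-321 : ℕ → Set
B-132-321 n = Σ (S n) λ { (σ , _) → isBallot σ × avoids σ p132 × avoids σ p321 }

-- A permutation σ = x τ avoiding 132 and 321 lists the entries below x in increasing order
-- (a decrease would make a 321 with x) and likewise the entries above x (a decrease would make
-- a 132 with x). Once an entry y < x has appeared, an entry above x can be followed only by
-- entries above x, since y, that entry and a later small entry form a 132. So τ = H₁ L H₂ with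
-- L = 1 ⋯ x−1 and H₁ H₂ = x+1 ⋯ N, i.e. σ is the identity or the block swap
-- (k+1 ⋯ k+m)(1 ⋯ k)(k+m+1 ⋯ N) with k, m ≥ 1. A block swap starts with m − 1 ascents followed
-- by its only descent, so it is ballot iff m ≥ 2; thus (k, m) ↦ (k, m − 1) matches
-- B_{n+1}(132,321) with S_n(132,321).
module Submission where

open import Defs
open import Data.Bool using (Bool; true; false; T; not; _∨_)
open import Data.Bool.ListAction using (any)
open import Data.Bool.Properties using (∨-assoc; ∨-identityʳ; T-∧; T-∨; T-≡; T-irrelevant)
open import Data.Empty using (⊥-elim)
open import Data.List using (List; []; _∷_; _++_; map; length; upTo; takeWhile)
open import Data.List.Properties using (∷-injective; length-++)
open import Data.List.Membership.Propositional using (_∈_)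
open import Data.List.Membership.Propositional.Properties
  using (∈-∃++; ∈-upTo⁺; ∈-upTo⁻; ∈-++⁺ˡ; ∈-++⁺ʳ; ∈-++⁻)
open import Data.List.Relation.Unary.All as All using (All; []; _∷_)
open import Data.List.Relation.Unary.All.Properties as Allₚ using (all⁺; all⁻)
open import Data.List.Relation.Unary.AllPairs as AllPairs using (AllPairs; []; _∷_)
import Data.List.Relation.Unary.AllPairs.Properties as AllPairsₚ
open import Data.List.Relation.Unary.Any as Any using (here; there)
open import Data.List.Relation.Unary.Unique.Propositional using (Unique)
open import Data.List.Relation.Binary.Permutation.Propositional
  using (_↭_; ↭-refl; ↭-sym; ↭-trans; prep; ↭⇒↭ₛ; module PermutationReasoning)
open import Data.List.Relation.Binary.Permutation.Propositional.Properties
  using (shift; shifts; ↭-length; ∈-resp-↭)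
import Data.List.Relation.Binary.Permutation.Setoid.Properties as SetoidPermutation
open import Data.List.Relation.Binary.Sublist.Propositional using (_⊆_; []; _∷_; _∷ʳ_; ⊆-refl)
open import Data.List.Relation.Binary.Sublist.Propositional.Properties as Sublist
  using (All-resp-⊆; Any-resp-⊆)
open import Data.Nat using (ℕ; zero; suc; pred; _+_; _∸_; _≤_; _<_; _<ᵇ_; _<?_; z≤n; s≤s)
open import Data.Nat.Properties
  using ( _≟_; ≡ᵇ⇒≡; ≡⇒≡ᵇ; <ᵇ⇒<; <⇒<ᵇ; 0≢1+n; 1+n≢0; suc-injective
        ; +-identityʳ; +-suc; +-assoc; m+[n∸m]≡n; ∸-+-assoc; +-monoʳ-≤; m≤m+n; m<m+n; n<1+n
        ; ≤-refl; ≤-trans; ≤-pred; <-trans; <-≤-trans; <⇒≤; <⇒≢; <⇒≯; ≤⇒≯; ≮⇒≥; ≤∧≢⇒<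
        ; <-irrefl; <-asym; <-cmp)
open import Data.Product as Σ using (∃; ∃₂; _×_; _,_; proj₁; proj₂)
open import Data.Product.Function.NonDependent.Propositional using (_×-⇔_)
open import Data.Sum using (_⊎_; inj₁; inj₂; [_,_]′)
open import Data.Sum.Function.Propositional using (_⊎-⇔_)
open import Data.Unit using (⊤; tt)
open import Function using (_$_; _∘_; _⇔_; mk⇔; Equivalence; _↔_; mk↔ₛ′)
open import Function.Properties.Equivalence using () renaming (trans to ⇔-trans)
open import Relation.Binary using (tri<; tri≈; tri>)
open import Relation.Binary.PropositionalEquality
  using (_≡_; _≢_; refl; sym; trans; cong; cong₂; subst; subst₂; ≢-sym; setoid; module ≡-Reasoning)
open import Relation.Nullary using (¬_; contradiction; yes; no)
open import Relation.Nullary.Decidable using (dec-true; dec-false)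
open import Relation.Unary using (Decidable)

open Equivalence using (to; from)

-- Avoiding a pattern of length three

¬T⇒≡false : ∀ {b} → ¬ T b → b ≡ false
¬T⇒≡false {true}  ¬b = contradiction tt ¬b
¬T⇒≡false {false} _  = refl

T-not-∨ : ∀ {a b} → T (not (a ∨ b)) ⇔ (T (not a) × T (not b))
T-not-∨ {true}  = mk⇔ (λ ()) (λ ())
T-not-∨ {false} = mk⇔ (tt ,_) proj₂

T-not⇔¬ : ∀ {b} {P : Set} → T b ⇔ P → T (not b) ⇔ (¬ P)
T-not⇔¬ {true}  b⇔P = mk⇔ (λ ()) (λ ¬P → ¬P (b⇔P .to tt))
T-not⇔¬ {false} b⇔P = mk⇔ (λ _ → b⇔P .from) (λ _ → tt)

<⇒<ᵇ≡true : ∀ {m n} → m < n → (m <ᵇ n) ≡ true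
<⇒<ᵇ≡true m<n = T-≡ .to (<⇒<ᵇ m<n)

≮⇒<ᵇ≡false : ∀ {m n} → ¬ m < n → (m <ᵇ n) ≡ false
≮⇒<ᵇ≡false {m} {n} m≮n = ¬T⇒≡false (m≮n ∘ <ᵇ⇒< m n)

<ᵇ≡true⇒< : ∀ {m n} → (m <ᵇ n) ≡ true → m < n
<ᵇ≡true⇒< {m} {n} eq = <ᵇ⇒< m n (T-≡ .from eq)

any-++ : ∀ {A : Set} (p : A → Bool) xs ys → any p (xs ++ ys) ≡ any p xs ∨ any p ys
any-++ p []       ys = refl
any-++ p (x ∷ xs) ys = trans (cong (p x ∨_) (any-++ p xs ys)) (sym (∨-assoc (p x) _ _))

any-map : ∀ {A B : Set} (p : B → Bool) (f : A → B) xs → any p (map f xs) ≡ any (p ∘ f) xs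
any-map p f []       = refl
any-map p f (x ∷ xs) = cong (p (f x) ∨_) (any-map p f xs)

any-const-false : ∀ {A : Set} (p : A → Bool) → (∀ u → p u ≡ false) → ∀ xs → any p xs ≡ false
any-const-false p never []       = refl
any-const-false p never (x ∷ xs) = trans (cong (_∨ any p xs) (never x)) (any-const-false p never xs)

any-subseqs-∷ : ∀ (p : List ℕ → Bool) x w →
  any p (subseqs (x ∷ w)) ≡ any (p ∘ (x ∷_)) (subseqs w) ∨ any p (subseqs w)
any-subseqs-∷ p x w = trans (any-++ p (map (x ∷_) (subseqs w)) (subseqs w))
                            (cong (_∨ any p (subseqs w)) (any-map p (x ∷_) (subseqs w)))

anySubseqOfLength : ℕ → (List ℕ → Bool) → List ℕ → Bool
anySubseqOfLength zero    p w       = p []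
anySubseqOfLength (suc k) p []      = false
anySubseqOfLength (suc k) p (x ∷ w) =
  anySubseqOfLength k (p ∘ (x ∷_)) w ∨ anySubseqOfLength (suc k) p w

any-subseqs : ∀ k (p : List ℕ → Bool) → (∀ u → T (p u) → length u ≡ k) →
  ∀ w → any p (subseqs w) ≡ anySubseqOfLength k p w
any-subseqs zero    p len []      = ∨-identityʳ (p [])
any-subseqs (suc k) p len []      = cong (_∨ false) (¬T⇒≡false (0≢1+n ∘ len []))
any-subseqs zero    p len (x ∷ w) = trans (any-subseqs-∷ p x w)
  (trans (cong (_∨ _) (any-const-false _ (λ u → ¬T⇒≡false (1+n≢0 ∘ len (x ∷ u))) (subseqs w)))
         (any-subseqs zero p len w))
any-subseqs (suc k) p len (x ∷ w) = trans (any-subseqs-∷ p x w)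
  (cong₂ _∨_ (any-subseqs k (p ∘ (x ∷_)) (λ u → suc-injective ∘ len (x ∷ u)) w)
             (any-subseqs (suc k) p len w))

AllTriples : (ℕ → ℕ → ℕ → Set) → List ℕ → Set
AllTriples R []      = ⊤
AllTriples R (x ∷ w) = AllPairs (R x) w × AllTriples R w

noSubseqOfLength₁ : ∀ {P : ℕ → Set} (p : List ℕ → Bool) → (∀ x → T (not (p (x ∷ []))) ⇔ P x) →
  ∀ w → T (not (anySubseqOfLength 1 p w)) ⇔ All P w
noSubseqOfLength₁ p p⇔P []      = mk⇔ (λ _ → []) (λ _ → tt)
noSubseqOfLength₁ p p⇔P (x ∷ w) = ⇔-trans T-not-∨
  (⇔-trans (p⇔P x ×-⇔ noSubseqOfLength₁ p p⇔P w) (mk⇔ (λ (px , pw) → px ∷ pw) All.uncons))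

noSubseqOfLength₂ : ∀ {R : ℕ → ℕ → Set} (p : List ℕ → Bool) →
  (∀ x y → T (not (p (x ∷ y ∷ []))) ⇔ R x y) →
  ∀ w → T (not (anySubseqOfLength 2 p w)) ⇔ AllPairs R w
noSubseqOfLength₂ p p⇔R []      = mk⇔ (λ _ → []) (λ _ → tt)
noSubseqOfLength₂ p p⇔R (x ∷ w) = ⇔-trans T-not-∨
  (⇔-trans (noSubseqOfLength₁ (p ∘ (x ∷_)) (p⇔R x) w ×-⇔ noSubseqOfLength₂ p p⇔R w)
           (mk⇔ (λ (rx , rw) → rx ∷ rw) AllPairs.uncons))

noSubseqOfLength₃ : ∀ {R : ℕ → ℕ → ℕ → Set} (p : List ℕ → Bool) →
  (∀ x y z → T (not (p (x ∷ y ∷ z ∷ []))) ⇔ R x y z) →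
  ∀ w → T (not (anySubseqOfLength 3 p w)) ⇔ AllTriples R w
noSubseqOfLength₃ p p⇔R []      = mk⇔ (λ _ → tt) (λ _ → tt)
noSubseqOfLength₃ p p⇔R (x ∷ w) =
  ⇔-trans T-not-∨ (noSubseqOfLength₂ (p ∘ (x ∷_)) (p⇔R x) w ×-⇔ noSubseqOfLength₃ p p⇔R w)

orderIsoᵇ-length : ∀ u v → T (orderIsoᵇ u v) → length u ≡ length v
orderIsoᵇ-length []      []      _ = refl
orderIsoᵇ-length (x ∷ u) (y ∷ v) t = cong suc (orderIsoᵇ-length u v (proj₂ (T-∧ .to t)))

avoids⇔AllTriples : ∀ {R : ℕ → ℕ → ℕ → Set} π → length π ≡ 3 →
  (∀ x y z → T (orderIsoᵇ (x ∷ y ∷ z ∷ []) π) ⇔ R x y z) →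
  ∀ σ → avoids σ π ⇔ AllTriples (λ x y z → ¬ R x y z) σ
avoids⇔AllTriples π len iso σ =
  subst (λ b → T (not b) ⇔ _) (sym (any-subseqs 3 _ (λ u t → trans (orderIsoᵇ-length u π t) len) σ))
        (noSubseqOfLength₃ _ (λ x y z → T-not⇔¬ (iso x y z)) σ)

-- orderIsoᵇ tests x<y, y<x, x<z, z<x, y<z, z<y in this order and stops at the first mismatch.
orderIsoᵇ-132 : ∀ x y z → T (orderIsoᵇ (x ∷ y ∷ z ∷ []) p132) ⇔ (x < z × z < y)
orderIsoᵇ-132 x y z = mk⇔ sound complete
  where
  sound : T (orderIsoᵇ (x ∷ y ∷ z ∷ []) p132) → x < z × z < y
  sound t with x <ᵇ y | y <ᵇ x | x <ᵇ z in x<z | z <ᵇ x | y <ᵇ z | z <ᵇ y in z<y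
  ... | false | _     | _     | _     | _     | _     = ⊥-elim t
  ... | true  | true  | _     | _     | _     | _     = ⊥-elim t
  ... | true  | false | false | _     | _     | _     = ⊥-elim t
  ... | true  | false | true  | true  | _     | _     = ⊥-elim t
  ... | true  | false | true  | false | true  | _     = ⊥-elim t
  ... | true  | false | true  | false | false | false = ⊥-elim t
  ... | true  | false | true  | false | false | true  = <ᵇ≡true⇒< x<z , <ᵇ≡true⇒< z<y
  complete : x < z × z < y → T (orderIsoᵇ (x ∷ y ∷ z ∷ []) p132)
  complete (x<z , z<y)
    rewrite <⇒<ᵇ≡true (<-trans x<z z<y) | ≮⇒<ᵇ≡false (<⇒≯ (<-trans x<z z<y))
          | <⇒<ᵇ≡true x<z | ≮⇒<ᵇ≡false (<⇒≯ x<z) | ≮⇒<ᵇ≡false (<⇒≯ z<y) | <⇒<ᵇ≡true z<y = tt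

orderIsoᵇ-321 : ∀ x y z → T (orderIsoᵇ (x ∷ y ∷ z ∷ []) p321) ⇔ (z < y × y < x)
orderIsoᵇ-321 x y z = mk⇔ sound complete
  where
  sound : T (orderIsoᵇ (x ∷ y ∷ z ∷ []) p321) → z < y × y < x
  sound t with x <ᵇ y | y <ᵇ x in y<x | x <ᵇ z | z <ᵇ x | y <ᵇ z | z <ᵇ y in z<y
  ... | true  | _     | _     | _     | _     | _     = ⊥-elim t
  ... | false | false | _     | _     | _     | _     = ⊥-elim t
  ... | false | true  | true  | _     | _     | _     = ⊥-elim t
  ... | false | true  | false | false | _     | _     = ⊥-elim t
  ... | false | true  | false | true  | true  | _     = ⊥-elim t
  ... | false | true  | false | true  | false | false = ⊥-elim t
  ... | false | true  | false | true  | false | true  = <ᵇ≡true⇒< z<y , <ᵇ≡true⇒< y<x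
  complete : z < y × y < x → T (orderIsoᵇ (x ∷ y ∷ z ∷ []) p321)
  complete (z<y , y<x)
    rewrite ≮⇒<ᵇ≡false (<⇒≯ y<x) | <⇒<ᵇ≡true y<x
          | ≮⇒<ᵇ≡false (<⇒≯ (<-trans z<y y<x)) | <⇒<ᵇ≡true (<-trans z<y y<x)
          | ≮⇒<ᵇ≡false (<⇒≯ z<y) | <⇒<ᵇ≡true z<y = tt

No132 No321 : ℕ → ℕ → ℕ → Set
No132 x y z = ¬ (x < z × z < y)
No321 x y z = ¬ (z < y × y < x)

avoids-132⇔ : ∀ σ → avoids σ p132 ⇔ AllTriples No132 σ
avoids-132⇔ = avoids⇔AllTriples p132 refl orderIsoᵇ-132

avoids-321⇔ : ∀ σ → avoids σ p321 ⇔ AllTriples No321 σ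
avoids-321⇔ = avoids⇔AllTriples p321 refl orderIsoᵇ-321

-- Intervals and permutations of [1..N]

range : ℕ → ℕ → List ℕ
range a zero    = []
range a (suc l) = a ∷ range (suc a) l

length-range : ∀ a l → length (range a l) ≡ l
length-range a zero    = refl
length-range a (suc l) = cong suc (length-range (suc a) l)

∈-range⁻ : ∀ {v} a l → v ∈ range a l → a ≤ v × v < a + l
∈-range⁻     a (suc l) (here refl) = ≤-refl , m<m+n a (s≤s z≤n)
∈-range⁻ {v} a (suc l) (there v∈) with ∈-range⁻ (suc a) l v∈
... | a<v , v<1+a+l = <⇒≤ a<v , subst (v <_) (sym (+-suc a l)) v<1+a+l

∈-range⁺ : ∀ {v} a l → a ≤ v → v < a + l → v ∈ range a l
∈-range⁺ {v} a zero    a≤v v<a+0 = contradiction (subst (v <_) (+-identityʳ a) v<a+0) (≤⇒≯ a≤v)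
∈-range⁺ {v} a (suc l) a≤v v<a+l with a ≟ v
... | yes refl = here refl
... | no  a≢v  = there (∈-range⁺ (suc a) l (≤∧≢⇒< a≤v a≢v) (subst (v <_) (+-suc a l) v<a+l))

range-increasing : ∀ a l → AllPairs _<_ (range a l)
range-increasing a zero    = []
range-increasing a (suc l) = All.tabulate (proj₁ ∘ ∈-range⁻ (suc a) l) ∷ range-increasing (suc a) l

range-unique : ∀ a l → Unique (range a l)
range-unique a l = AllPairs.map <⇒≢ (range-increasing a l)

range-++ : ∀ a l l′ → range a (l + l′) ≡ range a l ++ range (a + l) l′
range-++ a zero    l′ = cong (λ b → range b l′) (sym (+-identityʳ a))
range-++ a (suc l) l′ = cong (a ∷_)
  (trans (range-++ (suc a) l l′) (cong (λ b → range (suc a) l ++ range b l′) (sym (+-suc a l))))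

++≡range⁻ : ∀ A B a l → A ++ B ≡ range a l →
  A ≡ range a (length A) × B ≡ range (a + length A) (l ∸ length A)
++≡range⁻ []      B a l       eq = refl , trans eq (cong (λ b → range b l) (sym (+-identityʳ a)))
++≡range⁻ (x ∷ A) B a zero    ()
++≡range⁻ (x ∷ A) B a (suc l) eq with ∷-injective eq
... | refl , eq′ with ++≡range⁻ A B (suc a) l eq′
...   | A≡ , B≡ =
  cong (a ∷_) A≡ , trans B≡ (cong (λ b → range b (l ∸ length A)) (sym (+-suc a (length A))))

⊇∧length⇒↭ : ∀ {A : Set} {u w : List A} → Unique u → length w ≡ length u →
  (∀ {v} → v ∈ u → v ∈ w) → w ↭ u
⊇∧length⇒↭ {u = []}    {[]} _ _ _ = ↭-refl
⊇∧length⇒↭ {u = a ∷ u} (a∉u ∷ unique) len u⊆w with ∈-∃++ (u⊆w (here refl))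
... | as , bs , refl = ↭-trans (shift a as bs) (prep a (⊇∧length⇒↭ unique len′ u⊆as++bs))
  where
  len′ : length (as ++ bs) ≡ length u
  len′ = suc-injective (trans (sym (↭-length (shift a as bs))) len)
  u⊆as++bs : ∀ {v} → v ∈ u → v ∈ as ++ bs
  u⊆as++bs v∈u = Any.tail (λ v≡a → All.lookup a∉u v∈u (sym v≡a))
                          (∈-resp-↭ (shift a as bs) (u⊆w (there v∈u)))

Unique-resp-↭ : ∀ {A : Set} {u w : List A} → u ↭ w → Unique u → Unique w
Unique-resp-↭ {A} = SetoidPermutation.Unique-resp-↭ (setoid A) ∘ ↭⇒↭ₛ

∈ᵇ⇔∈ : ∀ v w → T (v ∈ᵇ w) ⇔ v ∈ w
∈ᵇ⇔∈ v []      = mk⇔ (λ ()) (λ ())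
∈ᵇ⇔∈ v (y ∷ w) = ⇔-trans T-∨
  (⇔-trans (mk⇔ (≡ᵇ⇒≡ v y) (≡⇒≡ᵇ v y) ⊎-⇔ ∈ᵇ⇔∈ v w) (mk⇔ [ here , there ]′ Any.toSum))

isPermᵇ⇔↭ : ∀ n w → T (isPermᵇ n w) ⇔ (w ↭ range 1 n)
isPermᵇ⇔↭ n w = mk⇔ sound complete
  where
  sound : T (isPermᵇ n w) → w ↭ range 1 n
  sound t = ⊇∧length⇒↭ (range-unique 1 n) length≡ covers
    where
    length≡ : length w ≡ length (range 1 n)
    length≡ = trans (≡ᵇ⇒≡ _ _ (proj₁ (T-∧ .to t))) (sym (length-range 1 n))
    covers : ∀ {v} → v ∈ range 1 n → v ∈ w
    covers {zero}  v∈ = contradiction (proj₁ (∈-range⁻ 1 n v∈)) λ ()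
    covers {suc i} v∈ = ∈ᵇ⇔∈ (suc i) w .to
      (All.lookup (all⁺ _ (upTo n) (proj₂ (T-∧ .to t)))
                  (∈-upTo⁺ (≤-pred (proj₂ (∈-range⁻ 1 n v∈)))))
  complete : w ↭ range 1 n → T (isPermᵇ n w)
  complete w↭ = T-∧ .from (≡⇒≡ᵇ _ _ (trans (↭-length w↭) (length-range 1 n)) , all⁻ _ covered)
    where
    covered : All (λ i → T (suc i ∈ᵇ w)) (upTo n)
    covered = All.tabulate λ i∈ → ∈ᵇ⇔∈ _ w .from
      (∈-resp-↭ (↭-sym w↭) (∈-range⁺ 1 n (s≤s z≤n) (s≤s (∈-upTo⁻ i∈))))

increasing-heads-≡ : ∀ {x y xs ys} → All (x <_) xs → All (y <_) ys → x ∈ y ∷ ys → y ∈ x ∷ xs → x ≡ y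
increasing-heads-≡ _  _  (here x≡y)  _           = x≡y
increasing-heads-≡ _  _  (there _)   (here y≡x)  = sym y≡x
increasing-heads-≡ x< y< (there x∈ys) (there y∈xs) =
  contradiction (All.lookup x< y∈xs) (<⇒≯ (All.lookup y< x∈ys))

increasing-ext : ∀ {xs ys} → AllPairs _<_ xs → AllPairs _<_ ys →
  (∀ {v} → v ∈ xs → v ∈ ys) → (∀ {v} → v ∈ ys → v ∈ xs) → xs ≡ ys
increasing-ext {[]}     {[]}     _ _ _   _   = refl
increasing-ext {[]}     {y ∷ ys} _ _ _   ys⊆ with () ← ys⊆ (here refl)
increasing-ext {x ∷ xs} {[]}     _ _ xs⊆ _   with () ← xs⊆ (here refl)
increasing-ext {x ∷ xs} {y ∷ ys} (x< ∷ ↑xs) (y< ∷ ↑ys) xs⊆ ys⊆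
  with increasing-heads-≡ x< y< (xs⊆ (here refl)) (ys⊆ (here refl))
... | refl = cong (x ∷_) (increasing-ext ↑xs ↑ys (drop-head x< xs⊆) (drop-head y< ys⊆))
  where
  drop-head : ∀ {us ws} → All (x <_) us → (∀ {v} → v ∈ x ∷ us → v ∈ x ∷ ws) →
    ∀ {v} → v ∈ us → v ∈ ws
  drop-head x<us us⊆ v∈us =
    Any.tail (λ v≡x → <-irrefl (sym v≡x) (All.lookup x<us v∈us)) (us⊆ (there v∈us))

AllPairs-resp-⊆ : ∀ {R : ℕ → ℕ → Set} {xs ys} → xs ⊆ ys → AllPairs R ys → AllPairs R xs
AllPairs-resp-⊆ []         []       = []
AllPairs-resp-⊆ (_ ∷ʳ p)   (_ ∷ rs) = AllPairs-resp-⊆ p rs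
AllPairs-resp-⊆ (refl ∷ p) (r ∷ rs) = All-resp-⊆ p r ∷ AllPairs-resp-⊆ p rs

AllPairs-restrict : ∀ {P : ℕ → Set} {R : ℕ → ℕ → Set} {xs} →
  All P xs → AllPairs (λ y z → P y → P z → R y z) xs → AllPairs R xs
AllPairs-restrict []         []       = []
AllPairs-restrict (py ∷ pys) (r ∷ rs) =
  All.zipWith (λ (pz , f) → f py pz) (pys , r) ∷ AllPairs-restrict pys rs

AllTriples-increasing : ∀ {R : ℕ → ℕ → ℕ → Set} {xs} → (∀ {x y z} → y < z → R x y z) →
  AllPairs _<_ xs → AllTriples R xs
AllTriples-increasing R< []         = tt
AllTriples-increasing R< (_ ∷ ↑xs) = AllPairs.map R< ↑xs , AllTriples-increasing R< ↑xs

AllTriples-++ : ∀ {R : ℕ → ℕ → ℕ → Set} {A D} → (∀ {x y z} → y < z → R x y z) →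
  (∀ {a a′ d} → a ∈ A → a′ ∈ A → a < a′ → d ∈ D → R a a′ d) →
  AllPairs _<_ A → AllPairs _<_ D → AllTriples R (A ++ D)
AllTriples-++ {A = []}    R< mixed _         ↑D = AllTriples-increasing R< ↑D
AllTriples-++ {A = a ∷ A} R< mixed (a< ∷ ↑A) ↑D =
  AllPairsₚ.++⁺ (AllPairs.map R< ↑A) (AllPairs.map R< ↑D)
    (All.tabulate λ a′∈A → All.tabulate (mixed (here refl) (there a′∈A) (All.lookup a< a′∈A)))
  , AllTriples-++ R< (λ a∈A a′∈A → mixed (there a∈A) (there a′∈A)) ↑A ↑D

-- Block swaps

swapBlocks : ℕ → ℕ × ℕ → List ℕ
swapBlocks N (k , m) = range (suc k) m ++ range 1 k ++ range (suc (k + m)) (N ∸ (k + m))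

data ValidSwap (N : ℕ) : ℕ × ℕ → Set where
  identity   : ValidSwap N (0 , 0)
  nontrivial : ∀ {k m} → suc k + suc m ≤ N → ValidSwap N (suc k , suc m)

ValidSwap⇒≤ : ∀ {N k m} → ValidSwap N (k , m) → k + m ≤ N
ValidSwap⇒≤ identity        = z≤n
ValidSwap⇒≤ (nontrivial le) = le

swapBlocks-↭ : ∀ N k m → k + m ≤ N → swapBlocks N (k , m) ↭ range 1 N
swapBlocks-↭ N k m k+m≤N = begin
  range (suc k) m ++ range 1 k ++ C  ↭⟨ shifts (range (suc k) m) (range 1 k) ⟩
  range 1 k ++ range (suc k) m ++ C  ≡⟨ cong (range 1 k ++_) (range-++ (suc k) m r) ⟨
  range 1 k ++ range (suc k) (m + r) ≡⟨ range-++ 1 k (m + r) ⟨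
  range 1 (k + (m + r))              ≡⟨ cong (range 1) (trans (sym (+-assoc k m r)) (m+[n∸m]≡n k+m≤N)) ⟩
  range 1 N                          ∎
  where
  open PermutationReasoning
  r : ℕ
  r = N ∸ (k + m)
  C : List ℕ
  C = range (suc (k + m)) r

module _ (N k m : ℕ) where
  private
    A B C : List ℕ
    A = range (suc k) m
    B = range 1 k
    C = range (suc (k + m)) (N ∸ (k + m))

    ↑B++C : AllPairs _<_ (B ++ C)
    ↑B++C = AllPairsₚ.++⁺ (range-increasing 1 k) (range-increasing _ _)
      (All.tabulate λ b∈B → All.tabulate λ c∈C →
        <-≤-trans (proj₂ (∈-range⁻ 1 k b∈B)) (≤-trans (s≤s (m≤m+n k m)) (proj₁ (∈-range⁻ _ _ c∈C))))

  swapBlocks-avoids-132 : AllTriples No132 (swapBlocks N (k , m))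
  swapBlocks-avoids-132 =
    AllTriples-++ (λ y<z (_ , z<y) → <-asym y<z z<y) mixed (range-increasing (suc k) m) ↑B++C
    where
    mixed : ∀ {a a′ d} → a ∈ A → a′ ∈ A → a < a′ → d ∈ B ++ C → No132 a a′ d
    mixed a∈A a′∈A _ d∈B++C (a<d , d<a′) with ∈-++⁻ B d∈B++C
    ... | inj₁ d∈B = <-asym a<d (<-≤-trans (proj₂ (∈-range⁻ 1 k d∈B)) (proj₁ (∈-range⁻ _ _ a∈A)))
    ... | inj₂ d∈C = <-asym d<a′ (<-≤-trans (proj₂ (∈-range⁻ _ _ a′∈A)) (proj₁ (∈-range⁻ _ _ d∈C)))

  swapBlocks-avoids-321 : AllTriples No321 (swapBlocks N (k , m))
  swapBlocks-avoids-321 = AllTriples-++ (λ y<z (z<y , _) → <-asym y<z z<y)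
    (λ _ _ a<a′ _ (_ , a′<a) → <-asym a<a′ a′<a) (range-increasing (suc k) m) ↑B++C

takeWhile-++ : ∀ {A : Set} {P : A → Set} (P? : Decidable P) {xs y ys} →
  All P xs → ¬ P y → takeWhile P? (xs ++ y ∷ ys) ≡ xs
takeWhile-++ P? []         ¬py rewrite dec-false (P? _) ¬py = refl
takeWhile-++ P? (px ∷ pxs) ¬py rewrite dec-true (P? _) px = cong (_ ∷_) (takeWhile-++ P? pxs ¬py)

-- The first entry is k + 1 and the entry 1 sits at position m + 1.
decode : List ℕ → ℕ × ℕ
decode []        = 0 , 0
decode σ@(x ∷ _) = pred x , length (takeWhile (1 <?_) σ)

decode-swapBlocks : ∀ {N c} → ValidSwap N c → decode (swapBlocks N c) ≡ c
decode-swapBlocks {zero}  identity = refl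
decode-swapBlocks {suc N} identity = refl
decode-swapBlocks (nontrivial {k} {m} _) = cong (λ l → suc k , suc l) (trans
  (cong length (takeWhile-++ (1 <?_) 1<A (<-irrefl refl))) (length-range _ m))
  where
  1<A : All (1 <_) (range (suc (suc (suc k))) m)
  1<A = All.tabulate (λ v∈ → ≤-trans (s≤s (s≤s z≤n)) (proj₁ (∈-range⁻ _ m v∈)))

-- Classification of S_N(132,321)

blocks⇒swapBlocks : ∀ n x′ H₁ L H₂ → suc x′ ≤ suc n → L ≡ range 1 x′ →
  H₁ ++ H₂ ≡ range (suc (suc x′)) (suc n ∸ suc x′) →
  ∃ λ c → ValidSwap (suc n) c × swapBlocks (suc n) c ≡ suc x′ ∷ H₁ ++ L ++ H₂
blocks⇒swapBlocks n zero    H₁ L H₂ _   refl H≡ = (0 , 0) , identity , cong (1 ∷_) (sym H≡)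
blocks⇒swapBlocks n (suc k) H₁ L H₂ x≤N refl H≡ with ++≡range⁻ H₁ H₂ _ _ H≡
... | H₁≡ , H₂≡ = (suc k , suc h) , nontrivial valid , cong (x ∷_) (sym blocks≡)
  where
  x h : ℕ
  x = suc (suc k)
  h = length H₁
  x+h≡ : suc k + suc h ≡ x + h
  x+h≡ = +-suc (suc k) h
  h≤ : h ≤ suc n ∸ x
  h≤ = subst (h ≤_) (trans (cong length H≡) (length-range _ _))
             (subst (h ≤_) (sym (length-++ H₁)) (m≤m+n h _))
  valid : suc k + suc h ≤ suc n
  valid = subst₂ _≤_ (sym x+h≡) (m+[n∸m]≡n x≤N) (+-monoʳ-≤ x h≤)
  blocks≡ : H₁ ++ L ++ H₂ ≡ range (suc x) h ++ L ++ range (suc (suc k + suc h)) (suc n ∸ (suc k + suc h))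
  blocks≡ = cong₂ (λ A B → A ++ L ++ B) H₁≡ (trans H₂≡
    (cong₂ range (cong suc (sym x+h≡)) (trans (∸-+-assoc (suc n) x h) (cong (suc n ∸_) (sym x+h≡)))))

larger-after-smaller : ∀ x y τ → All (λ v → v < x ⊎ x < v) τ → All (λ v → v < x → y < v) τ →
  AllPairs (No132 y) τ → ∃₂ λ L H → τ ≡ L ++ H × All (_< x) L × All (x <_) H
larger-after-smaller x y [] _ _ _ = [] , [] , refl , [] , []
larger-after-smaller x y (z ∷ τ) (inj₁ z<x ∷ sides) (_ ∷ y<) (_ ∷ no132)
  with larger-after-smaller x y τ sides y< no132
... | L , H , refl , L<x , x<H = z ∷ L , H , refl , z<x ∷ L<x , x<H
larger-after-smaller x y (z ∷ τ) (inj₂ x<z ∷ sides) (_ ∷ y<) (no132 ∷ _) =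
  [] , z ∷ τ , refl , [] , x<z ∷ All.tabulate larger
  where
  larger : ∀ {v} → v ∈ τ → x < v
  larger {v} v∈τ with All.lookup sides v∈τ
  ... | inj₂ x<v = x<v
  ... | inj₁ v<x = contradiction (All.lookup y< v∈τ v<x , <-trans v<x x<z) (All.lookup no132 v∈τ)

split-around : ∀ x τ → All (λ v → v < x ⊎ x < v) τ → AllPairs (λ y z → y < x → z < x → y < z) τ →
  AllTriples No132 τ →
  ∃₂ λ H₁ L → ∃ λ H₂ → τ ≡ H₁ ++ L ++ H₂ × All (x <_) H₁ × All (_< x) L × All (x <_) H₂
split-around x [] _ _ _ = [] , [] , [] , refl , [] , [] , []
split-around x (y ∷ τ) (inj₂ x<y ∷ sides) (_ ∷ ↑smaller) (_ , no132)
  with split-around x τ sides ↑smaller no132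
... | H₁ , L , H₂ , refl , x<H₁ , L<x , x<H₂ = y ∷ H₁ , L , H₂ , refl , x<y ∷ x<H₁ , L<x , x<H₂
split-around x (y ∷ τ) (inj₁ y<x ∷ sides) (y< ∷ _) (no132 , _)
  with larger-after-smaller x y τ sides (All.map (_$ y<x) y<) no132
... | L , H₂ , refl , L<x , x<H₂ = [] , y ∷ L , H₂ , refl , [] , y<x ∷ L<x , x<H₂

module FirstEntry {n x′ τ} (perm : suc x′ ∷ τ ↭ range 1 (suc n))
  (no132 : AllTriples No132 (suc x′ ∷ τ)) (no321 : AllTriples No321 (suc x′ ∷ τ)) where

  x : ℕ
  x = suc x′

  ∈σ⁻ : ∀ {v} → v ∈ x ∷ τ → 1 ≤ v × v < suc (suc n)
  ∈σ⁻ = ∈-range⁻ 1 (suc n) ∘ ∈-resp-↭ perm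

  ∈τ⁺ : ∀ {v} → 1 ≤ v → v < suc (suc n) → v ≢ x → v ∈ τ
  ∈τ⁺ 1≤v v<2+n v≢x = Any.tail v≢x (∈-resp-↭ (↭-sym perm) (∈-range⁺ 1 (suc n) 1≤v v<2+n))

  x≤N : x ≤ suc n
  x≤N = ≤-pred (proj₂ (∈σ⁻ (here refl)))

  σ-unique : Unique (x ∷ τ)
  σ-unique = Unique-resp-↭ (↭-sym perm) (range-unique 1 (suc n))

  sides : All (λ v → v < x ⊎ x < v) τ
  sides = All.map side (AllPairs.head σ-unique)
    where
    side : ∀ {v} → x ≢ v → v < x ⊎ x < v
    side {v} x≢v with <-cmp v x
    ... | tri< v<x _ _ = inj₁ v<x
    ... | tri≈ _ v≡x _ = contradiction (sym v≡x) x≢v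
    ... | tri> _ _ x<v = inj₂ x<v

  smaller-increasing : AllPairs (λ y z → y < x → z < x → y < z) τ
  smaller-increasing = AllPairs.zipWith
    (λ (avoid , y≢z) y<x _ → ≤∧≢⇒< (≮⇒≥ (λ z<y → avoid (z<y , y<x))) y≢z)
    (proj₁ no321 , AllPairs.tail σ-unique)

  larger-increasing : AllPairs (λ y z → x < y → x < z → y < z) τ
  larger-increasing = AllPairs.zipWith
    (λ (avoid , y≢z) _ x<z → ≤∧≢⇒< (≮⇒≥ (λ z<y → avoid (x<z , z<y))) y≢z)
    (proj₁ no132 , AllPairs.tail σ-unique)

  module Blocks {H₁ L H₂} (τ≡ : τ ≡ H₁ ++ L ++ H₂)
    (x<H₁ : All (x <_) H₁) (L<x : All (_< x) L) (x<H₂ : All (x <_) H₂) where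

    L⊆τ : L ⊆ τ
    L⊆τ = subst (L ⊆_) (sym τ≡) (Sublist.++⁺ˡ H₁ (Sublist.++⁺ʳ H₂ ⊆-refl))

    H⊆τ : H₁ ++ H₂ ⊆ τ
    H⊆τ = subst (H₁ ++ H₂ ⊆_) (sym τ≡) (Sublist.++⁺ (⊆-refl {x = H₁}) (Sublist.++⁺ˡ L ⊆-refl))

    x<H : All (x <_) (H₁ ++ H₂)
    x<H = Allₚ.++⁺ x<H₁ x<H₂

    ∈τ⇒∈L⊎H : ∀ {v} → v ∈ τ → v ∈ L ⊎ v ∈ H₁ ++ H₂
    ∈τ⇒∈L⊎H {v} v∈τ with ∈-++⁻ H₁ (subst (v ∈_) τ≡ v∈τ)
    ... | inj₁ v∈H₁ = inj₂ (∈-++⁺ˡ v∈H₁)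
    ... | inj₂ v∈LH₂ with ∈-++⁻ L v∈LH₂
    ...   | inj₁ v∈L  = inj₁ v∈L
    ...   | inj₂ v∈H₂ = inj₂ (∈-++⁺ʳ H₁ v∈H₂)

    L≡range : L ≡ range 1 x′
    L≡range = increasing-ext (AllPairs-restrict L<x (AllPairs-resp-⊆ L⊆τ smaller-increasing))
      (range-increasing 1 x′) L⊆range range⊆L
      where
      L⊆range : ∀ {v} → v ∈ L → v ∈ range 1 x′
      L⊆range v∈L = ∈-range⁺ 1 x′ (proj₁ (∈σ⁻ (there (Any-resp-⊆ L⊆τ v∈L)))) (All.lookup L<x v∈L)
      range⊆L : ∀ {v} → v ∈ range 1 x′ → v ∈ L
      range⊆L v∈ with ∈-range⁻ 1 x′ v∈
      ... | 1≤v , v<x with ∈τ⇒∈L⊎H (∈τ⁺ 1≤v (<-trans v<x (s≤s x≤N)) (<⇒≢ v<x))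
      ...   | inj₁ v∈L = v∈L
      ...   | inj₂ v∈H = contradiction (All.lookup x<H v∈H) (<⇒≯ v<x)

    H≡range : H₁ ++ H₂ ≡ range (suc x) (suc n ∸ x)
    H≡range = increasing-ext (AllPairs-restrict x<H (AllPairs-resp-⊆ H⊆τ larger-increasing))
      (range-increasing (suc x) (suc n ∸ x)) H⊆range range⊆H
      where
      top : suc x + (suc n ∸ x) ≡ suc (suc n)
      top = cong suc (m+[n∸m]≡n x≤N)
      H⊆range : ∀ {v} → v ∈ H₁ ++ H₂ → v ∈ range (suc x) (suc n ∸ x)
      H⊆range {v} v∈H = ∈-range⁺ (suc x) (suc n ∸ x) (All.lookup x<H v∈H)
        (subst (v <_) (sym top) (proj₂ (∈σ⁻ (there (Any-resp-⊆ H⊆τ v∈H)))))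
      range⊆H : ∀ {v} → v ∈ range (suc x) (suc n ∸ x) → v ∈ H₁ ++ H₂
      range⊆H {v} v∈ with ∈-range⁻ (suc x) (suc n ∸ x) v∈
      ... | x<v , v<top
        with ∈τ⇒∈L⊎H (∈τ⁺ (≤-trans (s≤s z≤n) x<v) (subst (v <_) top v<top) (≢-sym (<⇒≢ x<v)))
      ...   | inj₁ v∈L = contradiction (All.lookup L<x v∈L) (<⇒≯ x<v)
      ...   | inj₂ v∈H = v∈H

  classification : ∃ λ c → ValidSwap (suc n) c × swapBlocks (suc n) c ≡ x ∷ τ
  classification with split-around x τ sides smaller-increasing (proj₂ no132)
  ... | H₁ , L , H₂ , τ≡ , x<H₁ , L<x , x<H₂ =
    Σ.map₂ (Σ.map₂ (λ eq → trans eq (cong (x ∷_) (sym τ≡))))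
           (blocks⇒swapBlocks n x′ H₁ L H₂ x≤N L≡range H≡range)
    where open Blocks τ≡ x<H₁ L<x x<H₂

classify : ∀ N σ → σ ↭ range 1 N → AllTriples No132 σ → AllTriples No321 σ →
  ∃ λ c → ValidSwap N c × swapBlocks N c ≡ σ
classify zero    []           _    _     _     = (0 , 0) , identity , refl
classify zero    (_ ∷ _)      perm _     _     with () ← ↭-length perm
classify (suc n) []           perm _     _     with () ← ↭-length perm
classify (suc n) (zero ∷ τ)   perm _     _
  with () ← proj₁ (∈-range⁻ 1 (suc n) (∈-resp-↭ perm (here refl)))
classify (suc n) (suc x′ ∷ τ) perm no132 no321 = FirstEntry.classification perm no132 no321

decode-correct : ∀ N σ → σ ↭ range 1 N → AllTriples No132 σ → AllTriples No321 σ →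
  ValidSwap N (decode σ) × swapBlocks N (decode σ) ≡ σ
decode-correct N σ perm no132 no321 with classify N σ perm no132 no321
... | c , valid , refl rewrite decode-swapBlocks valid = valid , refl

-- Ballot block swaps

ballotFrom-run : ∀ a bal l w → ballotFrom a bal (range (suc a) l ++ w) ≡ ballotFrom (a + l) (bal + l) w
ballotFrom-run a bal zero    w rewrite +-identityʳ a | +-identityʳ bal = refl
ballotFrom-run a bal (suc l) w rewrite <⇒<ᵇ≡true (n<1+n a) | +-suc a l | +-suc bal l =
  ballotFrom-run (suc a) (suc bal) l w

ballotFrom-increasing : ∀ {prev a} bal l → prev < a → ballotFrom prev bal (range a l) ≡ true
ballotFrom-increasing         bal zero    _      = refl
ballotFrom-increasing {a = a} bal (suc l) prev<a rewrite <⇒<ᵇ≡true prev<a =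
  ballotFrom-increasing (suc bal) l (n<1+n a)

shrink grow : ℕ × ℕ → ℕ × ℕ
shrink (k , m) = k , pred m
grow (zero  , _) = 0 , 0
grow (suc k , m) = suc k , suc m

grow-valid : ∀ {n c} → ValidSwap n c → ValidSwap (suc n) (grow c)
grow-valid     identity                = identity
grow-valid {n} (nontrivial {k} {m} le) =
  nontrivial (subst (_≤ suc n) (sym (+-suc (suc k) (suc m))) (s≤s le))

-- With m = 1 the swap starts with a descent, so the ballot condition fails at once.
shrink-valid : ∀ {n c} → ValidSwap (suc n) c → isBallot (swapBlocks (suc n) c) → ValidSwap n (shrink c)
shrink-valid     identity                     _  = identity
shrink-valid     (nontrivial {m = zero} _)    ()
shrink-valid {n} (nontrivial {k} {suc m} le) _  =
  nontrivial (≤-pred (subst (_≤ suc n) (+-suc (suc k) (suc m)) le))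

grow-ballot : ∀ {n c} → ValidSwap n c → isBallot (swapBlocks (suc n) (grow c))
grow-ballot {n} identity = T-≡ .from (ballotFrom-increasing 0 n (n<1+n 1))
grow-ballot {n} (nontrivial {k} {m} _) = T-≡ .from (begin
  ballotFrom (suc (suc k)) 0 (range (suc (suc (suc k))) (suc m) ++ range 1 (suc k) ++ C)
    ≡⟨ ballotFrom-run (suc (suc k)) 0 (suc m) (range 1 (suc k) ++ C) ⟩
  ballotFrom 1 m (range 2 k ++ C)
    ≡⟨ ballotFrom-run 1 m k C ⟩
  ballotFrom (1 + k) (m + k) C
    ≡⟨ ballotFrom-increasing (m + k) r (s≤s (s≤s (m≤m+n k (suc (suc m))))) ⟩
  true ∎)
  where
  open ≡-Reasoning
  r : ℕ
  r = suc n ∸ (suc k + suc (suc m))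
  C : List ℕ
  C = range (suc (suc k + suc (suc m))) r

shrink-grow : ∀ {n c} → ValidSwap n c → shrink (grow c) ≡ c
shrink-grow identity       = refl
shrink-grow (nontrivial _) = refl

grow-shrink : ∀ {n c} → ValidSwap (suc n) c → isBallot (swapBlocks (suc n) c) → grow (shrink c) ≡ c
grow-shrink identity                   _  = refl
grow-shrink (nontrivial {m = zero} _)  ()
grow-shrink (nontrivial {m = suc m} _) _  = refl

word : ∀ {N} → S-132-321 N → List ℕ
word ((σ , _) , _) = σ

forget-ballot : ∀ {N} → B-132-321 N → S-132-321 N
forget-ballot (σ , _ , a₁ , a₂) = σ , a₁ , a₂

is-ballot : ∀ {N} (b : B-132-321 N) → isBallot (word (forget-ballot b))
is-ballot (_ , ballot , _) = ballot

S-132-321-≡ : ∀ {N} {s s′ : S-132-321 N} → word s ≡ word s′ → s ≡ s′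
S-132-321-≡ {s = (_ , p) , a₁ , a₂} {(_ , p′) , a₁′ , a₂′} refl
  rewrite T-irrelevant p p′ | T-irrelevant a₁ a₁′ | T-irrelevant a₂ a₂′ = refl

B-132-321-≡ : ∀ {N} {b b′ : B-132-321 N} → word (forget-ballot b) ≡ word (forget-ballot b′) → b ≡ b′
B-132-321-≡ {b = (_ , p) , c , a₁ , a₂} {(_ , p′) , c′ , a₁′ , a₂′} refl
  rewrite T-irrelevant p p′ | T-irrelevant c c′ | T-irrelevant a₁ a₁′ | T-irrelevant a₂ a₂′ = refl

swapBlocks-S : ∀ {N c} → ValidSwap N c → S-132-321 N
swapBlocks-S {N} {k , m} valid =
  (swapBlocks N (k , m) , isPermᵇ⇔↭ N _ .from (swapBlocks-↭ N k m (ValidSwap⇒≤ valid))) ,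
  avoids-132⇔ _ .from (swapBlocks-avoids-132 N k m) , avoids-321⇔ _ .from (swapBlocks-avoids-321 N k m)

decode-S : ∀ {N} (s : S-132-321 N) →
  ValidSwap N (decode (word s)) × swapBlocks N (decode (word s)) ≡ word s
decode-S ((σ , p) , a₁ , a₂) =
  decode-correct _ σ (isPermᵇ⇔↭ _ σ .to p) (avoids-132⇔ σ .to a₁) (avoids-321⇔ σ .to a₂)

B→S : ∀ n → B-132-321 (suc n) → S-132-321 n
B→S n b = swapBlocks-S (shrink-valid valid (subst isBallot (sym eq) (is-ballot b)))
  where
  σ : List ℕ
  σ = word (forget-ballot b)
  valid : ValidSwap (suc n) (decode σ)
  valid = proj₁ (decode-S (forget-ballot b))
  eq : swapBlocks (suc n) (decode σ) ≡ σ
  eq = proj₂ (decode-S (forget-ballot b))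

S→B : ∀ n → S-132-321 n → B-132-321 (suc n)
S→B n s = proj₁ swapped , grow-ballot valid , proj₂ swapped
  where
  valid : ValidSwap n (decode (word s))
  valid = proj₁ (decode-S s)
  swapped : S-132-321 (suc n)
  swapped = swapBlocks-S (grow-valid valid)

B→S∘S→B : ∀ n s → B→S n (S→B n s) ≡ s
B→S∘S→B n s = S-132-321-≡ (begin
  swapBlocks n (shrink (decode (swapBlocks (suc n) (grow c))))
    ≡⟨ cong (swapBlocks n ∘ shrink) (decode-swapBlocks (grow-valid valid)) ⟩
  swapBlocks n (shrink (grow c))
    ≡⟨ cong (swapBlocks n) (shrink-grow valid) ⟩
  swapBlocks n c
    ≡⟨ proj₂ (decode-S s) ⟩
  word s ∎)
  where
  open ≡-Reasoning
  c : ℕ × ℕ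
  c = decode (word s)
  valid : ValidSwap n c
  valid = proj₁ (decode-S s)

S→B∘B→S : ∀ n b → S→B n (B→S n b) ≡ b
S→B∘B→S n b = B-132-321-≡ (begin
  swapBlocks (suc n) (grow (decode (swapBlocks n (shrink c))))
    ≡⟨ cong (swapBlocks (suc n) ∘ grow) (decode-swapBlocks (shrink-valid valid ballot)) ⟩
  swapBlocks (suc n) (grow (shrink c))
    ≡⟨ cong (swapBlocks (suc n)) (grow-shrink valid ballot) ⟩
  swapBlocks (suc n) c
    ≡⟨ eq ⟩
  word (forget-ballot b) ∎)
  where
  open ≡-Reasoning
  c : ℕ × ℕ
  c = decode (word (forget-ballot b))
  valid : ValidSwap (suc n) c
  valid = proj₁ (decode-S (forget-ballot b))
  eq : swapBlocks (suc n) c ≡ word (forget-ballot b)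
  eq = proj₂ (decode-S (forget-ballot b))
  ballot : isBallot (swapBlocks (suc n) c)
  ballot = subst isBallot (sym eq) (is-ballot b)

-- The bijection exists for n = 0 as well.
theorem3p10 : (n : ℕ) → 1 ≤ n → B-132-321 (suc n) ↔ S-132-321 n
theorem3p10 n _ = mk↔ₛ′ (B→S n) (S→B n) (B→S∘S→B n) (S→B∘B→S n)
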